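{- Let $\mathcal{N}$ be a Gaussian integer and let $y,z$ be real with $y\ge z\ge2$. For a prime ideal $\mathfrak{q}$ put $\mathcal{A}_\mathfrak{q}=\{n\in\mathcal{A}:\mathfrak{q}\mid\mathfrak{n}\}$. Then $$T_1:=\sum_{\substack{n\in\mathcal{A}\\ N(\mathfrak{n},P(z))=1}}\ \sum_{\substack{z\le N(\mathfrak{q})<y\\ \mathfrak{q}^k\,\|\,\mathfrak{n}}}k\ \le\ \sum_{z\le N(\mathfrak{q})<y}S(\mathcal{A}_\mathfrak{q},\mathcal{P},z)+O\!\left(\frac{N(\mathcal{N})}{z}\right),$$ where the sums over $\mathfrak{q}$ run over prime ideals of $\mathbb{Z}[i]$ and the implied constant is absolute.
   Context: $N(\cdot)$ is the norm on $\mathbb{Z}[i]$ and its ideals; $\mathfrak{n}=(n)$. $\mathcal{P}$ is the set of Gaussian primes not dividing $\mathcal{N}$, $\mathcal{A}=\{\mathcal{N}-p:\ p\in\mathcal{P},\ N(p)<N(\mathcal{N})\}$ (one element per such prime $p$). For real $z\ge2$, $P(z)$ is the product of the prime ideals $(p)$ with $p\in\mathcal{P}$, $N(p)<z$; $N(\mathfrak{n},P(z))$ is the norm of the gcd of $\mathfrak{n}$ and $P(z)$. For a finite collection $\mathcal{C}$ of Gaussian integers, $S(\mathcal{C},\mathcal{P},z)$ is the number of $n\in\mathcal{C}$ with $N(\mathfrak{n},P(z))=1$. In $\mathfrak{q}^k\|\mathfrak{n}$, $k$ is the exact exponent of $\mathfrak{q}$ in $\mathfrak{n}$.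
   Formalization: The parameters $y,z$ are rational rather than real. -}

module Defs where

open import Data.Nat as ℕ using (ℕ; zero; suc)
open import Data.Integer as ℤ using (ℤ; +_; ∣_∣)
open import Data.Rational as ℚ using (ℚ; _/_)
open import Data.Product using (Σ; ∃; _×_)
open import Data.Sum using (_⊎_)
open import Data.List using (List)
open import Data.List.Relation.Unary.Any using (Any)
open import Relation.Nullary using (¬_)
open import Relation.Binary.PropositionalEquality using (_≡_)

record GI : Set where
  constructor _+i_
  field
    re : ℤ
    im : ℤ
open GI public

0ᴳ 1ᴳ : GI
0ᴳ = (+ 0) +i (+ 0)
1ᴳ = (+ 1) +i (+ 0)

infixl 7 _*ᴳ_
infixl 6 _-ᴳ_
_*ᴳ_ : GI → GI → GI
(a +i b) *ᴳ (c +i d) = (a ℤ.* c ℤ.- b ℤ.* d) +i (a ℤ.* d ℤ.+ b ℤ.* c)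

_-ᴳ_ : GI → GI → GI
(a +i b) -ᴳ (c +i d) = (a ℤ.- c) +i (b ℤ.- d)

_^ᴳ_ : GI → ℕ → GI
x ^ᴳ zero = 1ᴳ
x ^ᴳ suc k = x *ᴳ (x ^ᴳ k)

-- the norm N(a+bi) = a² + b² (also the norm of the ideal (a+bi))
Nm : GI → ℕ
Nm (a +i b) = ∣ a ℤ.* a ℤ.+ b ℤ.* b ∣

-- divisibility in ℤ[i]  (equivalently, of principal ideals)
infix 4 _∣ᴳ_
_∣ᴳ_ : GI → GI → Set
x ∣ᴳ y = ∃ λ c → y ≡ x *ᴳ c

IsUnit : GI → Set
IsUnit u = u ∣ᴳ 1ᴳ

-- associates: generate the same ideal
Assoc : GI → GI → Set
Assoc x y = x ∣ᴳ y × y ∣ᴳ x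

-- Gaussian prime: (p) is a nonzero prime ideal
GPrime : GI → Set
GPrime p = ¬ (p ≡ 0ᴳ) × ¬ IsUnit p ×
           (∀ a b → p ∣ᴳ a *ᴳ b → p ∣ᴳ a ⊎ p ∣ᴳ b)

ExactPow : GI → ℕ → GI → Set
ExactPow q k n = (q ^ᴳ k) ∣ᴳ n × ¬ ((q ^ᴳ suc k) ∣ᴳ n)

ℕ→ℚ : ℕ → ℚ
ℕ→ℚ n = (+ n) / 1

-- n ∈ 𝒜 :  n = 𝒩 - p for some p ∈ 𝒫 (Gaussian prime, p ∤ 𝒩) with N(p) < N(𝒩)
In𝒜 : GI → GI → Set
In𝒜 𝒩 n = ∃ λ p → GPrime p × ¬ (p ∣ᴳ 𝒩) × Nm p ℕ.< Nm 𝒩 × n ≡ 𝒩 -ᴳ p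

-- N(𝔫, P(z)) = 1 : no prime ideal (q), q ∈ 𝒫 (q ∤ 𝒩), N(q) < z, divides 𝔫
Rough : GI → ℚ → GI → Set
Rough 𝒩 z n = ∀ q → GPrime q → ¬ (q ∣ᴳ 𝒩) → ℚ._<_ (ℕ→ℚ (Nm q)) z → ¬ (q ∣ᴳ n)

InRange : ℚ → ℚ → GI → Set
InRange z y q = ℚ._≤_ z (ℕ→ℚ (Nm q)) × ℚ._<_ (ℕ→ℚ (Nm q)) y

-- Swap the order of summation: T₁ = Σ_𝔮 Σ_{n ∈ 𝒜} v_𝔮(n).  For fixed 𝔮 the inner sum is
-- #{n : 𝔮 ∣ n} + Σ_n (v_𝔮(n) − 1)⁺; the first term is at most S(𝒜_𝔮, 𝒫, z), and the excess
-- counts, for each j ≥ 2, the n with 𝔮^j ∣ n.  Every n ∈ 𝒜 has N(n) < 4 N(𝒩), and the nonzero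
-- multiples of 𝔮^j in that disc are at most 36 N(𝒩) / N(𝔮)^j by a lattice-point count, so the
-- excess is at most 72 N(𝒩) / N(𝔮)².  Finally Σ_{N(𝔮) ≥ z} 1 / N(𝔮)² ≤ 36 / z by a dyadic
-- decomposition, as there are at most 18 z Gaussian integers of norm below 2 z.  Hence
-- z T₁ ≤ z S + 2592 N(𝒩).

module Submission where

open import Defs

module GaussianArithmetic where

  open import Data.Nat as ℕ using (zero; suc; _+_; _*_; _^_; _≤_)
  import Data.Nat.Properties as ℕ
  open import Data.Integer as ℤ using (+_; -[1+_]; ∣_∣)
  import Data.Integer.Properties as ℤ
  open import Data.Integer.Tactic.RingSolver using (solve-∀)
  open import Data.Product using (_,_)
  open import Data.List.Relation.Unary.AllPairs as AllPairs using (AllPairs)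
  open import Data.List.Relation.Unary.Unique.Propositional using (Unique)
  open import Relation.Binary.PropositionalEquality
  open import Relation.Nullary using (¬_)
  open ≡-Reasoning

  *ᴳ-assoc : ∀ x y w → (x *ᴳ y) *ᴳ w ≡ x *ᴳ (y *ᴳ w)
  *ᴳ-assoc (a +i b) (c +i d) (e +i f) = cong₂ _+i_ (reᴱ a b c d e f) (imᴱ a b c d e f)
    where
    reᴱ : ∀ a b c d e f → (a ℤ.* c ℤ.- b ℤ.* d) ℤ.* e ℤ.- (a ℤ.* d ℤ.+ b ℤ.* c) ℤ.* f
                      ≡ a ℤ.* (c ℤ.* e ℤ.- d ℤ.* f) ℤ.- b ℤ.* (c ℤ.* f ℤ.+ d ℤ.* e)
    reᴱ = solve-∀
    imᴱ : ∀ a b c d e f → (a ℤ.* c ℤ.- b ℤ.* d) ℤ.* f ℤ.+ (a ℤ.* d ℤ.+ b ℤ.* c) ℤ.* e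
                      ≡ a ℤ.* (c ℤ.* f ℤ.+ d ℤ.* e) ℤ.+ b ℤ.* (c ℤ.* e ℤ.- d ℤ.* f)
    imᴱ = solve-∀

  *ᴳ-identityˡ : ∀ x → 1ᴳ *ᴳ x ≡ x
  *ᴳ-identityˡ (a +i b) = cong₂ _+i_ (reᴱ a b) (imᴱ a b)
    where
    reᴱ : ∀ a b → ℤ.1ℤ ℤ.* a ℤ.- ℤ.0ℤ ℤ.* b ≡ a
    reᴱ = solve-∀
    imᴱ : ∀ a b → ℤ.1ℤ ℤ.* b ℤ.+ ℤ.0ℤ ℤ.* a ≡ b
    imᴱ = solve-∀

  *ᴳ-identityʳ : ∀ x → x *ᴳ 1ᴳ ≡ x
  *ᴳ-identityʳ (a +i b) = cong₂ _+i_ (reᴱ a b) (imᴱ a b)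
    where
    reᴱ : ∀ a b → a ℤ.* ℤ.1ℤ ℤ.- b ℤ.* ℤ.0ℤ ≡ a
    reᴱ = solve-∀
    imᴱ : ∀ a b → a ℤ.* ℤ.0ℤ ℤ.+ b ℤ.* ℤ.1ℤ ≡ b
    imᴱ = solve-∀

  *ᴳ-zeroʳ : ∀ x → x *ᴳ 0ᴳ ≡ 0ᴳ
  *ᴳ-zeroʳ (a +i b) = cong₂ _+i_ (reᴱ a b) (imᴱ a b)
    where
    reᴱ : ∀ a b → a ℤ.* ℤ.0ℤ ℤ.- b ℤ.* ℤ.0ℤ ≡ ℤ.0ℤ
    reᴱ = solve-∀
    imᴱ : ∀ a b → a ℤ.* ℤ.0ℤ ℤ.+ b ℤ.* ℤ.0ℤ ≡ ℤ.0ℤ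
    imᴱ = solve-∀

  Assoc-refl : ∀ x → Assoc x x
  Assoc-refl x = (1ᴳ , sym (*ᴳ-identityʳ x)) , (1ᴳ , sym (*ᴳ-identityʳ x))

  nonassociate⇒Unique : ∀ {xs} → AllPairs (λ x x′ → ¬ Assoc x x′) xs → Unique xs
  nonassociate⇒Unique = AllPairs.map (λ {x} x≁x′ x≡x′ → x≁x′ (subst (Assoc x) x≡x′ (Assoc-refl x)))

  ^ᴳ-+ : ∀ q j k → q ^ᴳ (j + k) ≡ q ^ᴳ j *ᴳ q ^ᴳ k
  ^ᴳ-+ q zero    k = sym (*ᴳ-identityˡ _)
  ^ᴳ-+ q (suc j) k = trans (cong (q *ᴳ_) (^ᴳ-+ q j k)) (sym (*ᴳ-assoc q _ _))

  q^k∣ᴳn⇒q^j∣ᴳn : ∀ {q j k n} → j ≤ k → q ^ᴳ k ∣ᴳ n → q ^ᴳ j ∣ᴳ n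
  q^k∣ᴳn⇒q^j∣ᴳn {q} {j} j≤k (c , n≡q^k*c) with ℕ.m≤n⇒∃[o]m+o≡n j≤k
  ... | i , refl = q ^ᴳ i *ᴳ c , trans n≡q^k*c
        (trans (cong (_*ᴳ c) (^ᴳ-+ q j i)) (*ᴳ-assoc (q ^ᴳ j) (q ^ᴳ i) c))

  private
    +[∣a∣*∣a∣]≡a*a : ∀ a → + (∣ a ∣ * ∣ a ∣) ≡ a ℤ.* a
    +[∣a∣*∣a∣]≡a*a (+ n)    = sym (ℤ.+◃n≡+n (n * n))
    +[∣a∣*∣a∣]≡a*a -[1+ n ] = sym (ℤ.+◃n≡+n (suc n * suc n))

  Nm≡∣re∣²+∣im∣² : ∀ x → Nm x ≡ ∣ re x ∣ * ∣ re x ∣ + ∣ im x ∣ * ∣ im x ∣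
  Nm≡∣re∣²+∣im∣² (a +i b) =
    cong ∣_∣ (trans (sym (cong₂ ℤ._+_ (+[∣a∣*∣a∣]≡a*a a) (+[∣a∣*∣a∣]≡a*a b)))
                    (sym (ℤ.pos-+ (∣ a ∣ * ∣ a ∣) (∣ b ∣ * ∣ b ∣))))

  +Nm≡re²+im² : ∀ x → + Nm x ≡ re x ℤ.* re x ℤ.+ im x ℤ.* im x
  +Nm≡re²+im² x@(a +i b) = begin
    + Nm x                                        ≡⟨ cong +_ (Nm≡∣re∣²+∣im∣² x) ⟩
    + (∣ a ∣ * ∣ a ∣ + ∣ b ∣ * ∣ b ∣)               ≡⟨ ℤ.pos-+ (∣ a ∣ * ∣ a ∣) _ ⟩
    + (∣ a ∣ * ∣ a ∣) ℤ.+ + (∣ b ∣ * ∣ b ∣)         ≡⟨ cong₂ ℤ._+_ (+[∣a∣*∣a∣]≡a*a a) (+[∣a∣*∣a∣]≡a*a b) ⟩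
    a ℤ.* a ℤ.+ b ℤ.* b                           ∎

  Nm-* : ∀ x y → Nm (x *ᴳ y) ≡ Nm x * Nm y
  Nm-* x@(a +i b) y@(c +i d) = ℤ.+-injective (begin
    + Nm (x *ᴳ y)                                ≡⟨ +Nm≡re²+im² (x *ᴳ y) ⟩
    re (x *ᴳ y) ℤ.* re (x *ᴳ y) ℤ.+ im (x *ᴳ y) ℤ.* im (x *ᴳ y)
                                                 ≡⟨ brahmagupta a b c d ⟩
    (a ℤ.* a ℤ.+ b ℤ.* b) ℤ.* (c ℤ.* c ℤ.+ d ℤ.* d)
                                                 ≡⟨ sym (cong₂ ℤ._*_ (+Nm≡re²+im² x) (+Nm≡re²+im² y)) ⟩
    + Nm x ℤ.* + Nm y                            ≡⟨ sym (ℤ.pos-* (Nm x) (Nm y)) ⟩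
    + (Nm x * Nm y)                              ∎)
    where
    brahmagupta : ∀ a b c d →
      (a ℤ.* c ℤ.- b ℤ.* d) ℤ.* (a ℤ.* c ℤ.- b ℤ.* d) ℤ.+ (a ℤ.* d ℤ.+ b ℤ.* c) ℤ.* (a ℤ.* d ℤ.+ b ℤ.* c)
        ≡ (a ℤ.* a ℤ.+ b ℤ.* b) ℤ.* (c ℤ.* c ℤ.+ d ℤ.* d)
    brahmagupta = solve-∀

  Nm-^ᴳ : ∀ q j → Nm (q ^ᴳ j) ≡ Nm q ^ j
  Nm-^ᴳ q zero    = refl
  Nm-^ᴳ q (suc j) = trans (Nm-* q _) (cong (Nm q *_) (Nm-^ᴳ q j))

  infixl 6 _+ᴳ_
  _+ᴳ_ : GI → GI → GI
  (a +i b) +ᴳ (c +i d) = (a ℤ.+ c) +i (b ℤ.+ d)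

  Nm-parallelogram : ∀ x y → Nm (x -ᴳ y) + Nm (x +ᴳ y) ≡ 2 * Nm x + 2 * Nm y
  Nm-parallelogram x@(a +i b) y@(c +i d) = ℤ.+-injective (begin
    + (Nm (x -ᴳ y) + Nm (x +ᴳ y))       ≡⟨ ℤ.pos-+ (Nm (x -ᴳ y)) _ ⟩
    + Nm (x -ᴳ y) ℤ.+ + Nm (x +ᴳ y)     ≡⟨ cong₂ ℤ._+_ (+Nm≡re²+im² (x -ᴳ y)) (+Nm≡re²+im² (x +ᴳ y)) ⟩
    _                                   ≡⟨ parallelogram a b c d ⟩
    + 2 ℤ.* (a ℤ.* a ℤ.+ b ℤ.* b) ℤ.+ + 2 ℤ.* (c ℤ.* c ℤ.+ d ℤ.* d)
                                        ≡⟨ sym (cong₂ (λ u w → + 2 ℤ.* u ℤ.+ + 2 ℤ.* w) (+Nm≡re²+im² x) (+Nm≡re²+im² y)) ⟩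
    + 2 ℤ.* + Nm x ℤ.+ + 2 ℤ.* + Nm y   ≡⟨ sym (cong₂ ℤ._+_ (ℤ.pos-* 2 (Nm x)) (ℤ.pos-* 2 (Nm y))) ⟩
    + (2 * Nm x) ℤ.+ + (2 * Nm y)       ≡⟨ sym (ℤ.pos-+ (2 * Nm x) _) ⟩
    + (2 * Nm x + 2 * Nm y)             ∎)
    where
    parallelogram : ∀ a b c d →
      (a ℤ.- c) ℤ.* (a ℤ.- c) ℤ.+ (b ℤ.- d) ℤ.* (b ℤ.- d) ℤ.+ ((a ℤ.+ c) ℤ.* (a ℤ.+ c) ℤ.+ (b ℤ.+ d) ℤ.* (b ℤ.+ d))
        ≡ + 2 ℤ.* (a ℤ.* a ℤ.+ b ℤ.* b) ℤ.+ + 2 ℤ.* (c ℤ.* c ℤ.+ d ℤ.* d)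
    parallelogram = solve-∀

  Nm[x-y]≤2Nm[x]+2Nm[y] : ∀ x y → Nm (x -ᴳ y) ≤ 2 * Nm x + 2 * Nm y
  Nm[x-y]≤2Nm[x]+2Nm[y] x y = subst (Nm (x -ᴳ y) ≤_) (Nm-parallelogram x y) (ℕ.m≤m+n _ _)

  Nm≡0⇒≡0ᴳ : ∀ x → Nm x ≡ 0 → x ≡ 0ᴳ
  Nm≡0⇒≡0ᴳ x@(a +i b) Nm≡0 = cong₂ _+i_
    (ℤ.∣i∣≡0⇒i≡0 (m*m≡0⇒m≡0 (ℕ.m+n≡0⇒m≡0 _ ∣a∣²+∣b∣²≡0)))
    (ℤ.∣i∣≡0⇒i≡0 (m*m≡0⇒m≡0 (ℕ.m+n≡0⇒n≡0 _ ∣a∣²+∣b∣²≡0)))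
    where
    m*m≡0⇒m≡0 : ∀ {m} → m * m ≡ 0 → m ≡ 0
    m*m≡0⇒m≡0 {zero} _ = refl
    ∣a∣²+∣b∣²≡0 : ∣ a ∣ * ∣ a ∣ + ∣ b ∣ * ∣ b ∣ ≡ 0
    ∣a∣²+∣b∣²≡0 = trans (sym (Nm≡∣re∣²+∣im∣² x)) Nm≡0

  ∣re∣²≤Nm : ∀ x → ∣ re x ∣ * ∣ re x ∣ ≤ Nm x
  ∣re∣²≤Nm x = subst (∣ re x ∣ * ∣ re x ∣ ≤_) (sym (Nm≡∣re∣²+∣im∣² x)) (ℕ.m≤m+n _ _)

  ∣im∣²≤Nm : ∀ x → ∣ im x ∣ * ∣ im x ∣ ≤ Nm x
  ∣im∣²≤Nm x = subst (∣ im x ∣ * ∣ im x ∣ ≤_) (sym (Nm≡∣re∣²+∣im∣² x)) (ℕ.m≤n+m _ _)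

  Nm≤s²+s² : ∀ {x s} → ∣ re x ∣ ≤ s → ∣ im x ∣ ≤ s → Nm x ≤ s * s + s * s
  Nm≤s²+s² {x} ∣re∣≤s ∣im∣≤s = subst (_≤ _) (sym (Nm≡∣re∣²+∣im∣² x))
    (ℕ.+-mono-≤ (ℕ.*-mono-≤ ∣re∣≤s ∣re∣≤s) (ℕ.*-mono-≤ ∣im∣≤s ∣im∣≤s))

module ListCounting where

  open import Data.Nat using (ℕ; _+_; _*_; _≤_; z≤n; s≤s)
  import Data.Nat.Properties as ℕ
  open import Data.Nat.Tactic.RingSolver using (solve-∀)
  open import Data.Nat.ListAction using (sum)
  open import Data.List using (List; []; _∷_; map; length; filter)
  open import Data.List.Properties using (length-removeAt′)
  open import Data.List.Membership.Propositional using (_∈_; _─_)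
  open import Data.List.Relation.Unary.Any using (here; there; index)
  open import Data.List.Relation.Unary.All as All using ()
  open import Data.List.Relation.Binary.Subset.Propositional using (_⊆_)
  open import Data.List.Relation.Unary.AllPairs using ([]; _∷_)
  open import Data.List.Relation.Unary.Unique.Propositional using (Unique)
  open import Relation.Binary.PropositionalEquality
  open import Relation.Nullary using (yes; no)
  open import Relation.Nullary.Negation using (contradiction)
  open import Relation.Unary using (Decidable)
  open import Relation.Unary.Properties using (∁?)

  module _ {A : Set} where

    ∈-─⁺ : ∀ {x y} {ys : List A} (y∈ys : y ∈ ys) → x ∈ ys → x ≢ y → x ∈ ys ─ y∈ys
    ∈-─⁺ (here refl) (here refl) x≢y  = contradiction refl x≢y
    ∈-─⁺ (here _)    (there x∈ys) _   = x∈ys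
    ∈-─⁺ (there _)   (here refl) _    = here refl
    ∈-─⁺ (there y∈ys) (there x∈ys) x≢y = there (∈-─⁺ y∈ys x∈ys x≢y)

    Unique∧⊆⇒length≤ : ∀ {xs ys : List A} → Unique xs → xs ⊆ ys → length xs ≤ length ys
    Unique∧⊆⇒length≤ {[]}     _ _ = z≤n
    Unique∧⊆⇒length≤ {x ∷ xs} {ys} (x≢xs ∷ xs!) x∷xs⊆ys =
      ℕ.≤-trans (s≤s (Unique∧⊆⇒length≤ xs! xs⊆ys─x)) (ℕ.≤-reflexive (sym (length-removeAt′ ys (index x∈ys))))
      where
      x∈ys : x ∈ ys
      x∈ys = x∷xs⊆ys (here refl)
      xs⊆ys─x : xs ⊆ ys ─ x∈ys
      xs⊆ys─x x′∈xs = ∈-─⁺ x∈ys (x∷xs⊆ys (there x′∈xs)) (λ x′≡x → All.lookup x≢xs x′∈xs (sym x′≡x))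

    ∈⇒≤sum-map : ∀ (f : A → ℕ) {x xs} → x ∈ xs → f x ≤ sum (map f xs)
    ∈⇒≤sum-map f (here refl)  = ℕ.m≤m+n _ _
    ∈⇒≤sum-map f (there x∈xs) = ℕ.≤-trans (∈⇒≤sum-map f x∈xs) (ℕ.m≤n+m _ _)

    sum-map-mono : ∀ {f g : A → ℕ} xs → (∀ {x} → x ∈ xs → f x ≤ g x) → sum (map f xs) ≤ sum (map g xs)
    sum-map-mono []       _     = z≤n
    sum-map-mono (x ∷ xs) f≤g = ℕ.+-mono-≤ (f≤g (here refl)) (sum-map-mono xs (λ x∈xs → f≤g (there x∈xs)))

    sum-map-≡0 : ∀ {f : A → ℕ} xs → (∀ {x} → x ∈ xs → f x ≡ 0) → sum (map f xs) ≡ 0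
    sum-map-≡0 []       _     = refl
    sum-map-≡0 (x ∷ xs) f≡0 rewrite f≡0 (here refl) = sum-map-≡0 xs (λ x∈xs → f≡0 (there x∈xs))

    sum-map-+ : ∀ (f g : A → ℕ) xs → sum (map (λ x → f x + g x) xs) ≡ sum (map f xs) + sum (map g xs)
    sum-map-+ f g []       = refl
    sum-map-+ f g (x ∷ xs) rewrite sum-map-+ f g xs = interchange (f x) (g x) (sum (map f xs)) (sum (map g xs))
      where
      interchange : ∀ a b c d → a + b + (c + d) ≡ a + c + (b + d)
      interchange = solve-∀

    *-sum-map-≤ : ∀ (f : A → ℕ) c K xs → (∀ {x} → x ∈ xs → c * f x ≤ K) → c * sum (map f xs) ≤ length xs * K
    *-sum-map-≤ f c K []       _ rewrite ℕ.*-zeroʳ c = z≤n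
    *-sum-map-≤ f c K (x ∷ xs) cf≤K rewrite ℕ.*-distribˡ-+ c (f x) (sum (map f xs)) =
      ℕ.+-mono-≤ (cf≤K (here refl)) (*-sum-map-≤ f c K xs (λ x∈xs → cf≤K (there x∈xs)))

    sum-map-filter-∁ : ∀ (f : A → ℕ) {P : A → Set} (P? : Decidable P) xs →
      sum (map f xs) ≡ sum (map f (filter P? xs)) + sum (map f (filter (∁? P?) xs))
    sum-map-filter-∁ f P? []       = refl
    sum-map-filter-∁ f P? (x ∷ xs) with P? x
    ... | yes _ rewrite sum-map-filter-∁ f P? xs = sym (ℕ.+-assoc (f x) _ _)
    ... | no  _ rewrite sum-map-filter-∁ f P? xs = left-comm (f x) (sum (map f (filter P? xs))) _
      where
      left-comm : ∀ a b c → a + (b + c) ≡ b + (a + c)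
      left-comm = solve-∀

  sum-map-comm : ∀ {A B : Set} (g : A → B → ℕ) xs ys →
    sum (map (λ y → sum (map (λ x → g x y) xs)) ys) ≡ sum (map (λ x → sum (map (g x) ys)) xs)
  sum-map-comm g xs []       = sym (sum-map-≡0 xs (λ _ → refl))
  sum-map-comm g xs (y ∷ ys) rewrite sum-map-comm g xs ys = sym (sum-map-+ (λ x → g x y) (λ x → sum (map (g x) ys)) xs)

module NaturalsInRationals where

  open import Data.Nat as ℕ using (ℕ)
  open import Data.Integer as ℤ using (+_)
  import Data.Integer.Properties as ℤ
  open import Data.Rational as ℚ using (ℚ; mkℚ; _≤_; _+_; _*_)
  import Data.Rational.Properties as ℚ
  open import Data.Nat.Coprimality as Coprimality using ()
  open import Relation.Binary.PropositionalEquality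

  ℕ→ℚ≡mkℚ : ∀ n → ℕ→ℚ n ≡ mkℚ (+ n) 0 (Coprimality.sym (Coprimality.1-coprimeTo n))
  ℕ→ℚ≡mkℚ n = ℚ.normalize-coprime (Coprimality.sym (Coprimality.1-coprimeTo n))

  ℕ→ℚ-mono-≤ : ∀ {m n} → m ℕ.≤ n → ℕ→ℚ m ≤ ℕ→ℚ n
  ℕ→ℚ-mono-≤ {m} {n} m≤n rewrite ℕ→ℚ≡mkℚ m | ℕ→ℚ≡mkℚ n =
    ℚ.*≤* (subst₂ ℤ._≤_ (sym (ℤ.*-identityʳ (+ m))) (sym (ℤ.*-identityʳ (+ n))) (ℤ.+≤+ m≤n))

  ℕ→ℚ-cancel-≤ : ∀ {m n} → ℕ→ℚ m ≤ ℕ→ℚ n → m ℕ.≤ n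
  ℕ→ℚ-cancel-≤ {m} {n} m≤n rewrite ℕ→ℚ≡mkℚ m | ℕ→ℚ≡mkℚ n with m≤n
  ... | ℚ.*≤* m*1≤n*1 = ℤ.drop‿+≤+ (subst₂ ℤ._≤_ (ℤ.*-identityʳ (+ m)) (ℤ.*-identityʳ (+ n)) m*1≤n*1)

  ℕ→ℚ-+ : ∀ m n → ℕ→ℚ (m ℕ.+ n) ≡ ℕ→ℚ m + ℕ→ℚ n
  ℕ→ℚ-+ m n rewrite ℕ→ℚ≡mkℚ m | ℕ→ℚ≡mkℚ n =
    trans (ℕ→ℚ≡mkℚ (m ℕ.+ n)) (sym (trans (cong (ℚ._/ 1) m*1+n*1≡m+n) (ℕ→ℚ≡mkℚ (m ℕ.+ n))))
    where
    m*1+n*1≡m+n : + m ℤ.* + 1 ℤ.+ + n ℤ.* + 1 ≡ + (m ℕ.+ n)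
    m*1+n*1≡m+n = trans (cong₂ ℤ._+_ (ℤ.*-identityʳ (+ m)) (ℤ.*-identityʳ (+ n))) (sym (ℤ.pos-+ m n))

  ℕ→ℚ-* : ∀ m n → ℕ→ℚ (m ℕ.* n) ≡ ℕ→ℚ m * ℕ→ℚ n
  ℕ→ℚ-* m n rewrite ℕ→ℚ≡mkℚ m | ℕ→ℚ≡mkℚ n =
    trans (ℕ→ℚ≡mkℚ (m ℕ.* n)) (sym (trans (cong (ℚ._/ 1) (sym (ℤ.pos-* m n))) (ℕ→ℚ≡mkℚ (m ℕ.* n))))

  scaled-split : ∀ {z : ℚ} T S W {B} → ℕ→ℚ 0 ≤ z → T ℕ.≤ S ℕ.+ W → z * ℕ→ℚ W ≤ B →
    z * ℕ→ℚ T ≤ z * ℕ→ℚ S + B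
  scaled-split {z} T S W {B} 0≤z T≤S+W zW≤B = begin
    z * ℕ→ℚ T                  ≤⟨ ℚ.*-monoˡ-≤-nonNeg z (ℕ→ℚ-mono-≤ T≤S+W) ⟩
    z * ℕ→ℚ (S ℕ.+ W)          ≡⟨ cong (z *_) (ℕ→ℚ-+ S W) ⟩
    z * (ℕ→ℚ S + ℕ→ℚ W)        ≡⟨ ℚ.*-distribˡ-+ z (ℕ→ℚ S) (ℕ→ℚ W) ⟩
    z * ℕ→ℚ S + z * ℕ→ℚ W      ≤⟨ ℚ.+-monoʳ-≤ (z * ℕ→ℚ S) zW≤B ⟩
    z * ℕ→ℚ S + B              ∎
    where
    open ℚ.≤-Reasoning
    instance
      z≥0 : ℚ.NonNegative z
      z≥0 = ℚ.nonNegative 0≤z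

module LatticePoints where

  open import Data.Nat as ℕ using (ℕ; zero; suc; _+_; _*_; _≤_; _<_; _<?_; z≤n; s≤s)
  import Data.Nat.Properties as ℕ
  open import Data.Nat.Tactic.RingSolver using (solve-∀)
  open import Data.Integer using (ℤ; +_; -[1+_]; ∣_∣)
  open import Data.Product using (∃; _×_; _,_)
  open import Data.Sum using (_⊎_; inj₁; inj₂)
  open import Data.List using (List; []; _∷_; map; length; _++_; upTo; cartesianProductWith)
  open import Data.List.Properties using (length-++; length-map; length-upTo)
  open import Data.List.Membership.Propositional using (_∈_)
  open import Data.List.Membership.Propositional.Properties
    using (∈-++⁺ˡ; ∈-++⁺ʳ; ∈-map⁺; ∈-upTo⁺; ∈-cartesianProductWith⁺)
  open import Data.List.Relation.Unary.Any using (here)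
  open import Data.List.Relation.Binary.Subset.Propositional using (_⊆_)
  open import Data.List.Relation.Unary.Unique.Propositional using (Unique)
  open import Relation.Binary.PropositionalEquality
  open import Relation.Nullary using (yes; no)
  open import Relation.Nullary.Negation using (contradiction)
  open import Relation.Unary using (Decidable)
  open GaussianArithmetic
  open ListCounting

  interval : ℕ → List ℤ
  interval s = map -[1+_] (upTo s) ++ map +_ (upTo (suc s))

  length-interval : ∀ s → length (interval s) ≡ s + suc s
  length-interval s = trans (length-++ (map -[1+_] (upTo s)))
    (cong₂ _+_ (trans (length-map -[1+_] (upTo s)) (length-upTo s))
               (trans (length-map +_ (upTo (suc s))) (length-upTo (suc s))))

  ∈-interval : ∀ {a s} → ∣ a ∣ ≤ s → a ∈ interval s
  ∈-interval {+ n}      {s} n≤s   = ∈-++⁺ʳ (map -[1+_] (upTo s)) (∈-map⁺ +_ (∈-upTo⁺ (s≤s n≤s)))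
  ∈-interval { -[1+ n ]} 1+n≤s   = ∈-++⁺ˡ (∈-map⁺ -[1+_] (∈-upTo⁺ 1+n≤s))

  length-cartesianProductWith : ∀ {A B C : Set} (f : A → B → C) xs ys →
    length (cartesianProductWith f xs ys) ≡ length xs * length ys
  length-cartesianProductWith f []       ys = refl
  length-cartesianProductWith f (x ∷ xs) ys = trans (length-++ (map (f x) ys))
    (cong₂ _+_ (length-map (f x) ys) (length-cartesianProductWith f xs ys))

  square : ℕ → List GI
  square s = cartesianProductWith _+i_ (interval s) (interval s)

  ∈-square : ∀ {x s} → ∣ re x ∣ ≤ s → ∣ im x ∣ ≤ s → x ∈ square s
  ∈-square ∣re∣≤s ∣im∣≤s = ∈-cartesianProductWith⁺ _+i_ (∈-interval ∣re∣≤s) (∈-interval ∣im∣≤s)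

  length-square : ∀ s → length (square s) ≡ (s + suc s) * (s + suc s)
  length-square s = trans (length-cartesianProductWith _+i_ (interval s) (interval s))
    (cong₂ _*_ (length-interval s) (length-interval s))

  [s+1+s]²≤9s² : ∀ {s} → 1 ≤ s → (s + suc s) * (s + suc s) ≤ 9 * (s * s)
  [s+1+s]²≤9s² {s} 1≤s = subst ((s + suc s) * (s + suc s) ≤_) (3s*3s≡9s² s) (ℕ.*-mono-≤ 1+2s≤3s 1+2s≤3s)
    where
    1+2s≤3s : s + suc s ≤ s + (s + s)
    1+2s≤3s = ℕ.+-monoʳ-≤ s (ℕ.+-monoˡ-≤ s 1≤s)
    3s*3s≡9s² : ∀ s → (s + (s + s)) * (s + (s + s)) ≡ 9 * (s * s)
    3s*3s≡9s² = solve-∀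

  module _ {P : ℕ → Set} (P? : Decidable P) where

    greatest : ℕ → ℕ
    greatest zero = 0
    greatest (suc t) with P? (suc t)
    ... | yes _ = suc t
    ... | no  _ = greatest t

    greatest-satisfies : ∀ t → greatest t ≡ 0 ⊎ P (greatest t)
    greatest-satisfies zero = inj₁ refl
    greatest-satisfies (suc t) with P? (suc t)
    ... | yes Pt = inj₂ Pt
    ... | no  _  = greatest-satisfies t

    ≤-greatest : ∀ {u t} → u ≤ t → P u → u ≤ greatest t
    ≤-greatest {zero}            _   _  = z≤n
    ≤-greatest {suc u} {suc t} u≤t Pu with P? (suc t)
    ... | yes _   = u≤t
    ... | no ¬Pt with ℕ.m≤n⇒m<n∨m≡n u≤t
    ...   | inj₁ u<t  = ≤-greatest (ℕ.≤-pred u<t) Pu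
    ...   | inj₂ refl = contradiction Pu ¬Pt

  m≤n*[m*m] : ∀ m n .{{_ : ℕ.NonZero n}} → m ≤ n * (m * m)
  m≤n*[m*m] zero      n = z≤n
  m≤n*[m*m] m@(suc _) n = ℕ.≤-trans (ℕ.m≤m*n m m) (ℕ.m≤n*m (m * m) n)

  lattice-points-bound : ∀ (f : GI → GI) X Y (xs : List GI) → Unique xs →
    (∀ {x} → x ∈ xs → ∃ λ m → x ≡ f m × 1 ≤ Nm m × X * Nm m < Y) → X * length xs ≤ 9 * Y
  lattice-points-bound f zero Y xs _ _ = z≤n
  lattice-points-bound f X@(suc _) Y [] _ _ rewrite ℕ.*-zeroʳ X = z≤n
  lattice-points-bound f X@(suc _) Y xs@(_ ∷ _) xs! preimage = begin
    X * length xs                    ≤⟨ ℕ.*-monoʳ-≤ X (Unique∧⊆⇒length≤ xs! xs⊆f[square]) ⟩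
    X * length (map f (square s))    ≡⟨ cong (X *_) (trans (length-map f (square s)) (length-square s)) ⟩
    X * ((s + suc s) * (s + suc s))  ≤⟨ ℕ.*-monoʳ-≤ X ([s+1+s]²≤9s² (ℕ.n≢0⇒n>0 s≢0)) ⟩
    X * (9 * (s * s))                ≡⟨ left-comm X 9 (s * s) ⟩
    9 * (X * (s * s))                ≤⟨ ℕ.*-monoʳ-≤ 9 (ℕ.<⇒≤ Xs²<Y) ⟩
    9 * Y                            ∎
    where
    open ℕ.≤-Reasoning
    left-comm : ∀ a b c → a * (b * c) ≡ b * (a * c)
    left-comm = solve-∀
    -- Every preimage lies in the square [−s, s]², and s ≥ 1 makes its (2s+1)² points at most 9s².
    s : ℕ
    s = greatest (λ u → X * (u * u) <? Y) Y
    coordinate≤s : ∀ {c} m → c * c ≤ Nm m → X * Nm m < Y → c ≤ s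
    coordinate≤s {c} m c²≤Nm XNm<Y = ≤-greatest _ (ℕ.<⇒≤ (ℕ.≤-<-trans (m≤n*[m*m] c X) Xc²<Y)) Xc²<Y
      where
      Xc²<Y : X * (c * c) < Y
      Xc²<Y = ℕ.≤-<-trans (ℕ.*-monoʳ-≤ X c²≤Nm) XNm<Y
    ∣re∣≤s : ∀ m → X * Nm m < Y → ∣ re m ∣ ≤ s
    ∣re∣≤s m = coordinate≤s m (∣re∣²≤Nm m)
    ∣im∣≤s : ∀ m → X * Nm m < Y → ∣ im m ∣ ≤ s
    ∣im∣≤s m = coordinate≤s m (∣im∣²≤Nm m)
    xs⊆f[square] : xs ⊆ map f (square s)
    xs⊆f[square] x∈xs with preimage x∈xs
    ... | m , refl , _ , XNm<Y = ∈-map⁺ f (∈-square {m} (∣re∣≤s m XNm<Y) (∣im∣≤s m XNm<Y))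
    s≢0 : s ≢ 0
    s≢0 s≡0 with preimage (here refl)
    ... | m , _ , 1≤Nm , XNm<Y = contradiction
      (subst (λ t → 1 ≤ t * t + t * t) s≡0 (ℕ.≤-trans 1≤Nm (Nm≤s²+s² {m} (∣re∣≤s m XNm<Y) (∣im∣≤s m XNm<Y))))
      λ ()
    Xs²<Y : X * (s * s) < Y
    Xs²<Y with greatest-satisfies (λ u → X * (u * u) <? Y) Y
    ... | inj₁ s≡0   = contradiction s≡0 s≢0
    ... | inj₂ Xs²<Y = Xs²<Y

module LayerCake where

  open import Data.Nat as ℕ using (ℕ; zero; suc; _+_; _*_; _^_; _∸_; _≤_; _≤?_; z≤n; s≤s)
  import Data.Nat.Properties as ℕ
  open import Data.Nat.Tactic.RingSolver using (solve-∀)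
  open import Data.Nat.ListAction using (sum)
  open import Data.List using (List; []; _∷_; map; length; filter)
  open import Data.List.Properties using (filter-accept; filter-reject; map-cong)
  open import Data.List.Membership.Propositional using (_∈_)
  open import Data.List.Relation.Binary.Subset.Propositional using (_⊆_)
  open import Data.List.Relation.Unary.Unique.Propositional using (Unique)
  open import Data.List.Relation.Unary.Unique.Propositional.Properties using (filter⁺)
  open import Relation.Binary.PropositionalEquality
  open import Relation.Nullary using (yes; no)
  open ListCounting

  m∸n≡1+[m∸1+n] : ∀ {m n} → suc n ≤ m → m ∸ n ≡ suc (m ∸ suc n)
  m∸n≡1+[m∸1+n] {suc m} {zero}  _         = refl
  m∸n≡1+[m∸1+n] {suc m} {suc n} (s≤s n<m) = m∸n≡1+[m∸1+n] n<m

  module _ {A : Set} (v : A → ℕ) where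

    atLeast : ℕ → List A → List A
    atLeast j = filter (λ x → j ≤? v x)

    excess : ℕ → List A → ℕ
    excess j xs = sum (map (λ x → v x ∸ j) xs)

    excess-suc : ∀ j xs → excess j xs ≡ length (atLeast (suc j) xs) + excess (suc j) xs
    excess-suc j []       = refl
    excess-suc j (x ∷ xs) with suc j ≤? v x
    ... | yes j<v rewrite filter-accept (λ x → suc j ≤? v x) {xs = xs} j<v
                        | m∸n≡1+[m∸1+n] j<v | excess-suc j xs =
      cong suc (left-comm (v x ∸ suc j) (length (atLeast (suc j) xs)) _)
      where
      left-comm : ∀ a b c → a + (b + c) ≡ b + (a + c)
      left-comm = solve-∀
    ... | no  j≮v rewrite filter-reject (λ x → suc j ≤? v x) {xs = xs} j≮v
                        | ℕ.m≤n⇒m∸n≡0 (ℕ.≤-pred (ℕ.≰⇒> j≮v))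
                        | ℕ.m≤n⇒m∸n≡0 (ℕ.m≤n⇒m≤1+n (ℕ.≤-pred (ℕ.≰⇒> j≮v)))
                        | excess-suc j xs = refl

    -- excess j xs = Σ_{i > j} length (atLeast i xs), a series with terms at most K b⁻ⁱ and b ≥ 2.
    excess-geometric : ∀ {b K} xs → 2 ≤ b → (∀ j → b ^ suc j * length (atLeast (suc j) xs) ≤ K) →
      ∀ j → b ^ suc j * excess j xs ≤ K + K
    excess-geometric {b} {K} xs 2≤b count≤K j =
      bounded (sum (map v xs)) j (λ x∈xs → ℕ.≤-trans (∈⇒≤sum-map v x∈xs) (ℕ.m≤n+m _ j))
      where
      bounded : ∀ fuel j → (∀ {x} → x ∈ xs → v x ≤ j + fuel) → b ^ suc j * excess j xs ≤ K + K
      bounded zero j v≤j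
        rewrite sum-map-≡0 {f = λ x → v x ∸ j} xs
                  (λ {x} x∈xs → ℕ.m≤n⇒m∸n≡0 (subst (v x ≤_) (ℕ.+-identityʳ j) (v≤j x∈xs)))
              | ℕ.*-zeroʳ (b ^ suc j) = z≤n
      bounded (suc fuel) j v≤j+1+fuel
        rewrite excess-suc j xs
              | ℕ.*-distribˡ-+ (b ^ suc j) (length (atLeast (suc j) xs)) (excess (suc j) xs) =
        ℕ.+-mono-≤ (count≤K j) (ℕ.*-cancelˡ-≤ 2 (begin
          2 * (b ^ suc j * excess (suc j) xs)  ≤⟨ ℕ.*-monoˡ-≤ _ 2≤b ⟩
          b * (b ^ suc j * excess (suc j) xs)  ≡⟨ sym (ℕ.*-assoc b _ _) ⟩
          b ^ suc (suc j) * excess (suc j) xs  ≤⟨ bounded fuel (suc j) v≤1+j+fuel ⟩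
          K + K                                ≡⟨ cong (K +_) (sym (ℕ.+-identityʳ K)) ⟩
          2 * K                                ∎))
        where
        open ℕ.≤-Reasoning
        v≤1+j+fuel : ∀ {x} → x ∈ xs → v x ≤ suc j + fuel
        v≤1+j+fuel {x} x∈xs = subst (v x ≤_) (ℕ.+-suc j fuel) (v≤j+1+fuel x∈xs)

  exponent-sum-bound : ∀ {A B : Set} (v : A → B → ℕ) (As : List B) (Q : List A) (R : A → List B) →
    Unique As → (∀ {q} → q ∈ Q → atLeast (v q) 1 As ⊆ R q) →
    sum (map (λ n → sum (map (λ q → v q n) Q)) As)
      ≤ sum (map (λ q → length (R q)) Q) + sum (map (λ q → excess (v q) 1 As) Q)
  exponent-sum-bound v As Q R As! divisible⊆R = begin
    sum (map (λ n → sum (map (λ q → v q n) Q)) As)      ≡⟨ sum-map-comm v Q As ⟩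
    sum (map (λ q → sum (map (v q) As)) Q)              ≡⟨⟩
    sum (map (λ q → excess (v q) 0 As) Q)               ≡⟨ cong sum (map-cong (λ q → excess-suc (v q) 0 As) Q) ⟩
    sum (map (λ q → length (atLeast (v q) 1 As) + excess (v q) 1 As) Q)
                                                        ≤⟨ sum-map-mono Q (λ q∈Q →
                                                             ℕ.+-monoˡ-≤ _ (Unique∧⊆⇒length≤ (filter⁺ _ As!) (divisible⊆R q∈Q))) ⟩
    sum (map (λ q → length (R q) + excess (v q) 1 As) Q) ≡⟨ sum-map-+ (λ q → length (R q)) (λ q → excess (v q) 1 As) Q ⟩
    sum (map (λ q → length (R q)) Q) + sum (map (λ q → excess (v q) 1 As) Q) ∎
    where open ℕ.≤-Reasoning

module GaussianMultiples where

  open import Data.Nat as ℕ using (ℕ; suc; _+_; _*_; _^_; _≤_; _<_)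
  import Data.Nat.Properties as ℕ
  open import Data.Product using (∃; _×_; _,_)
  open import Data.List using (List; length)
  open import Data.List.Membership.Propositional using (_∈_)
  open import Data.List.Membership.Propositional.Properties using (∈-filter⁻)
  open import Data.List.Relation.Unary.Unique.Propositional using (Unique)
  open import Data.List.Relation.Unary.Unique.Propositional.Properties using (filter⁺)
  open import Relation.Binary.PropositionalEquality
  open GaussianArithmetic
  open LatticePoints
  open LayerCake

  nonzero-multiples-bound : ∀ d Y (xs : List GI) → Unique xs →
    (∀ {n} → n ∈ xs → d ∣ᴳ n × n ≢ 0ᴳ × Nm n < Y) → Nm d * length xs ≤ 9 * Y
  nonzero-multiples-bound d Y xs xs! multiple = lattice-points-bound (d *ᴳ_) (Nm d) Y xs xs! cofactor
    where
    cofactor : ∀ {n} → n ∈ xs → ∃ λ m → n ≡ d *ᴳ m × 1 ≤ Nm m × Nm d * Nm m < Y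
    cofactor n∈xs with multiple n∈xs
    ... | (m , n≡dm) , n≢0 , Nm<Y =
      m , n≡dm , ℕ.n≢0⇒n>0 Nm[m]≢0 , subst (_< Y) (trans (cong Nm n≡dm) (Nm-* d m)) Nm<Y
      where
      Nm[m]≢0 : Nm m ≢ 0
      Nm[m]≢0 Nm≡0 = n≢0 (trans n≡dm (trans (cong (d *ᴳ_) (Nm≡0⇒≡0ᴳ m Nm≡0)) (*ᴳ-zeroʳ d)))

  ExactPow⇒≢0ᴳ : ∀ q k {n} → ExactPow q k n → n ≢ 0ᴳ
  ExactPow⇒≢0ᴳ q k (_ , q^1+k∤n) refl = q^1+k∤n (0ᴳ , sym (*ᴳ-zeroʳ (q ^ᴳ suc k)))

  exact-power-excess-bound : ∀ q Y (v : GI → ℕ) (xs : List GI) → 2 ≤ Nm q → Unique xs →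
    (∀ {n} → n ∈ xs → Nm n < Y × ExactPow q (v n) n) → Nm q * Nm q * excess v 1 xs ≤ 9 * Y + 9 * Y
  exact-power-excess-bound q Y v xs 2≤Nm xs! valuation =
    subst (_≤ 9 * Y + 9 * Y) (cong (λ t → Nm q * t * excess v 1 xs) (ℕ.*-identityʳ (Nm q)))
      (excess-geometric v xs 2≤Nm multiples-bound 1)
    where
    multiples-bound : ∀ j → Nm q ^ suc j * length (atLeast v (suc j) xs) ≤ 9 * Y
    multiples-bound j = subst (λ t → t * length (atLeast v (suc j) xs) ≤ 9 * Y) (Nm-^ᴳ q (suc j))
      (nonzero-multiples-bound (q ^ᴳ suc j) Y (atLeast v (suc j) xs) (filter⁺ _ xs!) multiple)
      where
      multiple : ∀ {n} → n ∈ atLeast v (suc j) xs → q ^ᴳ suc j ∣ᴳ n × n ≢ 0ᴳ × Nm n < Y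
      multiple n∈ with ∈-filter⁻ _ {xs = xs} n∈
      ... | n∈xs , 1+j≤v with valuation n∈xs
      ...   | Nm<Y , exact@(q^v∣n , _) = q^k∣ᴳn⇒q^j∣ᴳn {q} 1+j≤v q^v∣n , ExactPow⇒≢0ᴳ q (v _) exact , Nm<Y

module InverseSquareTail where

  open import Data.Nat as ℕ using (ℕ; zero; suc; _+_; _*_; _≤_; _<_; _≤?_; z≤n; s≤s)
  import Data.Nat.Properties as ℕ
  open import Data.Nat.Tactic.RingSolver using (solve-∀)
  open import Data.Nat.ListAction using (sum)
  open import Data.Rational as ℚ using (ℚ)
  import Data.Rational.Properties as ℚ
  open import Data.Product using (_,_)
  open import Data.List using (List; []; _∷_; map; length; filter)
  open import Data.List.Membership.Propositional using (_∈_)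
  open import Data.List.Membership.Propositional.Properties using (∈-filter⁻)
  open import Data.List.Relation.Unary.All as All using (All; _∷_)
  open import Data.List.Relation.Unary.Unique.Propositional using (Unique)
  open import Data.List.Relation.Unary.Unique.Propositional.Properties using (filter⁺)
  open import Relation.Binary.PropositionalEquality
  open import Relation.Nullary using (Dec)
  open import Relation.Nullary.Negation using (contradiction)
  open import Relation.Unary.Properties using (∁?)
  open import Data.List.Extrema.Nat using (argmin; argmin-all; f[argmin]≤f[⊤]; f[argmin]≤f[xs])
  open GaussianArithmetic
  open ListCounting
  open LatticePoints
  open NaturalsInRationals

  module _ (w : GI → ℕ) (K : ℕ) where

    n²w≤K<n⇒w≡0 : ∀ {n} q → Nm q * Nm q * w q ≤ K → K < n → n ≤ Nm q → w q ≡ 0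
    n²w≤K<n⇒w≡0 q Nm²w≤K K<n n≤Nm with Nm q | w q
    ... | _          | zero  = refl
    ... | zero       | suc _ = contradiction (ℕ.<-≤-trans K<n n≤Nm) λ ()
    ... | N@(suc _)  | W@(suc _) = contradiction (ℕ.<-≤-trans K<n (ℕ.≤-trans n≤Nm N≤N²W)) (ℕ.≤⇒≯ Nm²w≤K)
      where
      N≤N²W : N ≤ N * N * W
      N≤N²W = ℕ.≤-trans (ℕ.m≤m*n N N) (ℕ.m≤m*n (N * N) W)

    inverse-square-tail : ∀ {z} (L : List GI) → 1 ≤ z → Unique L →
      (∀ {q} → q ∈ L → z ≤ Nm q) → (∀ {q} → q ∈ L → Nm q * Nm q * w q ≤ K) →
      z * sum (map w L) ≤ 36 * K
    inverse-square-tail {z} L 1≤z = dyadic K L 1≤z (ℕ.m<n+m K 1≤z)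
      where
      -- Split L at norm 2z: the far part is the same problem at scale 2z, while the near part has
      -- at most 18z elements, each of weight at most K / z².  Once z > K every weight vanishes,
      -- so K doublings suffice.
      dyadic : ∀ {z} fuel (L : List GI) → 1 ≤ z → K < z + fuel → Unique L →
        (∀ {q} → q ∈ L → z ≤ Nm q) → (∀ {q} → q ∈ L → Nm q * Nm q * w q ≤ K) →
        z * sum (map w L) ≤ 36 * K
      dyadic {z} zero L _ K<z+0 _ z≤Nm Nm²w≤K
        rewrite sum-map-≡0 L (λ {q} q∈L →
                  n²w≤K<n⇒w≡0 q (Nm²w≤K q∈L) (subst (K <_) (ℕ.+-identityʳ z) K<z+0) (z≤Nm q∈L))
              | ℕ.*-zeroʳ z = z≤n
      dyadic {z@(suc _)} (suc fuel) L 1≤z K<z+1+fuel L! z≤Nm Nm²w≤K = ℕ.*-cancelˡ-≤ 2 (begin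
        2 * (z * sum (map w L))                   ≡⟨ cong (λ t → 2 * (z * t)) (sum-map-filter-∁ w far? L) ⟩
        2 * (z * (sum (map w far) + sum (map w near)))
                                                  ≡⟨ distrib z (sum (map w far)) (sum (map w near)) ⟩
        2 * z * sum (map w far) + 2 * (z * sum (map w near))
                                                  ≤⟨ ℕ.+-mono-≤ far-bound (ℕ.*-monoʳ-≤ 2 near-bound) ⟩
        36 * K + 2 * (18 * K)                     ≡⟨ 36K+2[18K]≡2[36K] K ⟩
        2 * (36 * K)                              ∎)
        where
        open ℕ.≤-Reasoning
        distrib : ∀ z a b → 2 * (z * (a + b)) ≡ 2 * z * a + 2 * (z * b)
        distrib = solve-∀
        36K+2[18K]≡2[36K] : ∀ K → 36 * K + 2 * (18 * K) ≡ 2 * (36 * K)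
        36K+2[18K]≡2[36K] = solve-∀
        far? : ∀ q → Dec (2 * z ≤ Nm q)
        far? q = 2 * z ≤? Nm q
        far near : List GI
        far  = filter far? L
        near = filter (∁? far?) L
        far-bound : 2 * z * sum (map w far) ≤ 36 * K
        far-bound = dyadic fuel far (s≤s z≤n) K<2z+fuel (filter⁺ far? L!)
          (λ q∈far → let _ , 2z≤Nm = ∈-filter⁻ far? {xs = L} q∈far in 2z≤Nm)
          (λ q∈far → let q∈L , _ = ∈-filter⁻ far? {xs = L} q∈far in Nm²w≤K q∈L)
          where
          K<2z+fuel : K < 2 * z + fuel
          K<2z+fuel = ℕ.<-≤-trans K<z+1+fuel (begin
            z + suc fuel   ≡⟨ ℕ.+-suc z fuel ⟩
            suc z + fuel   ≤⟨ ℕ.+-monoˡ-≤ fuel (ℕ.+-monoˡ-≤ z 1≤z) ⟩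
            z + z + fuel   ≡⟨ cong (λ t → z + t + fuel) (sym (ℕ.+-identityʳ z)) ⟩
            2 * z + fuel   ∎)
        near-count : 1 * length near ≤ 9 * (2 * z)
        near-count = lattice-points-bound (λ x → x) 1 (2 * z) near (filter⁺ (∁? far?) L!) λ {x} x∈near →
          let x∈L , Nm<2z = ∈-filter⁻ (∁? far?) {xs = L} x∈near
          in x , refl , ℕ.≤-trans 1≤z (z≤Nm x∈L) , subst (_< 2 * z) (sym (ℕ.*-identityˡ (Nm x))) (ℕ.≰⇒> Nm<2z)
        near-bound : z * sum (map w near) ≤ 18 * K
        near-bound = ℕ.*-cancelˡ-≤ z (begin
          z * (z * sum (map w near))   ≡⟨ sym (ℕ.*-assoc z z _) ⟩
          z * z * sum (map w near)     ≤⟨ *-sum-map-≤ w (z * z) K near z²w≤K ⟩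
          length near * K              ≤⟨ ℕ.*-monoˡ-≤ K (subst (_≤ 9 * (2 * z)) (ℕ.*-identityˡ (length near)) near-count) ⟩
          9 * (2 * z) * K              ≡⟨ 9[2z]K≡z[18K] z K ⟩
          z * (18 * K)                 ∎)
          where
          9[2z]K≡z[18K] : ∀ z K → 9 * (2 * z) * K ≡ z * (18 * K)
          9[2z]K≡z[18K] = solve-∀
          z²w≤K : ∀ {q} → q ∈ near → z * z * w q ≤ K
          z²w≤K {q} q∈near = let q∈L , _ = ∈-filter⁻ (∁? far?) {xs = L} q∈near in
            ℕ.≤-trans (ℕ.*-monoˡ-≤ (w q) (ℕ.*-mono-≤ (z≤Nm q∈L) (z≤Nm q∈L))) (Nm²w≤K q∈L)

    inverse-square-tail-ℚ : ∀ {z : ℚ} (Q : List GI) → ℕ→ℚ 1 ℚ.≤ z → Unique Q →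
        All (λ q → z ℚ.≤ ℕ→ℚ (Nm q)) Q → (∀ {q} → q ∈ Q → Nm q * Nm q * w q ≤ K) →
        z ℚ.* ℕ→ℚ (sum (map w Q)) ℚ.≤ ℕ→ℚ (36 * K)
    inverse-square-tail-ℚ {z} [] _ _ _ _ = begin
        z ℚ.* ℕ→ℚ 0    ≡⟨ ℚ.*-zeroʳ z ⟩
        ℕ→ℚ 0          ≤⟨ ℕ→ℚ-mono-≤ {n = 36 * K} z≤n ⟩
        ℕ→ℚ (36 * K)   ∎
        where open ℚ.≤-Reasoning
    inverse-square-tail-ℚ {z} Q@(q₀ ∷ Qs) 1≤z Q! z≤Nm Nm²w≤K = begin
        z ℚ.* ℕ→ℚ W          ≤⟨ ℚ.*-monoʳ-≤-nonNeg (ℕ→ℚ W) z≤z₀ ⟩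
        ℕ→ℚ z₀ ℚ.* ℕ→ℚ W     ≡⟨ sym (ℕ→ℚ-* z₀ W) ⟩
        ℕ→ℚ (z₀ * W)         ≤⟨ ℕ→ℚ-mono-≤ {z₀ * W} (inverse-square-tail Q 1≤z₀ Q! (All.lookup z₀≤Nm) Nm²w≤K) ⟩
        ℕ→ℚ (36 * K)         ∎
        where
        open ℚ.≤-Reasoning
        W : ℕ
        W = sum (map w Q)
        instance
          W≥0 : ℚ.NonNegative (ℕ→ℚ W)
          W≥0 = ℚ.nonNegative (ℕ→ℚ-mono-≤ {0} {W} z≤n)
        z₀ : ℕ
        z₀ = Nm (argmin Nm q₀ Qs)
        z≤z₀ : z ℚ.≤ ℕ→ℚ z₀
        z≤z₀ = argmin-all Nm (All.head z≤Nm) (All.tail z≤Nm)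
        1≤z₀ : 1 ≤ z₀
        1≤z₀ = ℕ→ℚ-cancel-≤ {1} (ℚ.≤-trans 1≤z z≤z₀)
        z₀≤Nm : All (λ q → z₀ ≤ Nm q) Q
        z₀≤Nm = f[argmin]≤f[⊤] {f = Nm} q₀ Qs ∷ f[argmin]≤f[xs] {f = Nm} q₀ Qs

module ShiftedPrimes where

  open import Data.Nat as ℕ using (ℕ; _+_; _*_; _≤_; _<_)
  import Data.Nat.Properties as ℕ
  open import Data.Nat.Tactic.RingSolver using (solve-∀)
  open import Data.Product using (_×_; _,_; proj₁)
  open import Data.List using (List)
  open import Data.List.Membership.Propositional using (_∈_)
  open import Data.List.Membership.Propositional.Properties using (∈-filter⁻)
  open import Data.List.Relation.Binary.Subset.Propositional using (_⊆_)
  open import Data.List.Relation.Unary.Unique.Propositional using (Unique)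
  open import Function.Bundles using (_⇔_; Equivalence)
  open import Relation.Binary.PropositionalEquality
  open GaussianArithmetic
  open LayerCake
  open GaussianMultiples

  In𝒜⇒Nm<4Nm𝒩 : ∀ {𝒩 n} → In𝒜 𝒩 n → Nm n < 4 * Nm 𝒩
  In𝒜⇒Nm<4Nm𝒩 {𝒩} (p , _ , _ , Nm[p]<Nm[𝒩] , refl) = ℕ.≤-<-trans (Nm[x-y]≤2Nm[x]+2Nm[y] 𝒩 p)
    (subst (2 * Nm 𝒩 + 2 * Nm p <_) (2M+2M≡4M (Nm 𝒩)) (ℕ.+-monoʳ-< (2 * Nm 𝒩) (ℕ.*-monoʳ-< 2 Nm[p]<Nm[𝒩])))
    where
    2M+2M≡4M : ∀ M → 2 * M + 2 * M ≡ 4 * M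
    2M+2M≡4M = solve-∀

  Nm²*excess≤72Nm𝒩 : ∀ {𝒩 z q} (v : GI → ℕ) {A′ : List GI} → 2 ≤ Nm q → Unique A′ →
    (∀ n → (n ∈ A′) ⇔ (In𝒜 𝒩 n × Rough 𝒩 z n)) → (∀ {n} → n ∈ A′ → ExactPow q (v n) n) →
    Nm q * Nm q * excess v 1 A′ ≤ 72 * Nm 𝒩
  Nm²*excess≤72Nm𝒩 {𝒩} {q = q} v {A′} 2≤Nm A′! A′-spec exact =
    subst (Nm q * Nm q * excess v 1 A′ ≤_) (9[4M]+9[4M]≡72M (Nm 𝒩))
      (exact-power-excess-bound q (4 * Nm 𝒩) v A′ 2≤Nm A′!
        (λ {n} n∈A′ → In𝒜⇒Nm<4Nm𝒩 (proj₁ (Equivalence.to (A′-spec n) n∈A′)) , exact n∈A′))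
    where
    9[4M]+9[4M]≡72M : ∀ M → 9 * (4 * M) + 9 * (4 * M) ≡ 72 * M
    9[4M]+9[4M]≡72M = solve-∀

  divisible⊆R : ∀ {𝒩 z q} (v : GI → ℕ) {A′ R : List GI} →
    (∀ n → (n ∈ A′) ⇔ (In𝒜 𝒩 n × Rough 𝒩 z n)) →
    (∀ n → (n ∈ R) ⇔ ((In𝒜 𝒩 n × q ∣ᴳ n) × Rough 𝒩 z n)) →
    (∀ {n} → n ∈ A′ → ExactPow q (v n) n) → atLeast v 1 A′ ⊆ R
  divisible⊆R {q = q} v {A′} A′-spec R-spec exact {n} n∈ with ∈-filter⁻ _ {xs = A′} n∈
  ... | n∈A′ , 1≤v with Equivalence.to (A′-spec n) n∈A′
  ...   | n∈𝒜 , rough = Equivalence.from (R-spec n) ((n∈𝒜 , q∣n) , rough)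
    where
    q∣n : q ∣ᴳ n
    q∣n = subst (_∣ᴳ n) (*ᴳ-identityʳ q) (q^k∣ᴳn⇒q^j∣ᴳn {q} 1≤v (proj₁ (exact n∈A′)))

open import Data.Nat as ℕ using (ℕ)
open import Data.Rational as ℚ using (ℚ; _≤_; _+_; _*_)
open import Data.Product using (_×_; ∃)
open import Data.List using (List; map; length)
open import Data.Nat.ListAction using (sum)
open import Data.List.Membership.Propositional using (_∈_)
open import Data.List.Relation.Unary.Any using (Any)
open import Data.List.Relation.Unary.All using (All)
open import Data.List.Relation.Unary.AllPairs using (AllPairs)
open import Data.List.Relation.Unary.Unique.Propositional using (Unique)
open import Function.Bundles using (_⇔_)
open import Relation.Nullary using (¬_)

import Data.Nat.Properties as ℕ
import Data.Rational.Properties as ℚ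
open import Data.Product using (_,_)
import Data.List.Relation.Unary.All as All
open import Relation.Binary.PropositionalEquality
open GaussianArithmetic
open NaturalsInRationals
open LayerCake
open InverseSquareTail
open ShiftedPrimes

lemma3p2 : ∃ λ (C : ℕ) →
    ∀ (𝒩 : GI) (y z : ℚ) → ℕ→ℚ 2 ≤ z → z ≤ y →
    ∀ (Q : List GI) →
    All (λ q → GPrime q × InRange z y q) Q →
    AllPairs (λ q q′ → ¬ Assoc q q′) Q →
    (∀ q → GPrime q → InRange z y q → Any (Assoc q) Q) →
    ∀ (A′ : List GI) → Unique A′ →
    (∀ n → (n ∈ A′) ⇔ (In𝒜 𝒩 n × Rough 𝒩 z n)) →
    ∀ (R : GI → List GI) → (∀ q → Unique (R q)) →
    (∀ q n → (n ∈ R q) ⇔ ((In𝒜 𝒩 n × q ∣ᴳ n) × Rough 𝒩 z n)) →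
    ∀ (v : GI → GI → ℕ) →
    (∀ q n → q ∈ Q → n ∈ A′ → ExactPow q (v q n) n) →
    let T₁ = sum (map (λ n → sum (map (λ q → v q n) Q)) A′)
        S  = sum (map (λ q → length (R q)) Q)
    in z * ℕ→ℚ T₁ ≤ z * ℕ→ℚ S + ℕ→ℚ C * ℕ→ℚ (Nm 𝒩)
-- Only an upper bound is claimed.
lemma3p2 = 2592 , λ 𝒩 y z 2≤z _ Q Q-range Q-nonassociate _ A′ A′! A′-spec R _ R-spec v exact →
  let T₁ : ℕ
      T₁ = sum (map (λ n → sum (map (λ q → v q n) Q)) A′)
      S : ℕ
      S = sum (map (λ q → length (R q)) Q)
      W : ℕ
      W = sum (map (λ q → excess (v q) 1 A′) Q)
      z≤Nm : All (λ q → z ≤ ℕ→ℚ (Nm q)) Q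
      z≤Nm = All.map (λ (_ , z≤Nm[q] , _) → z≤Nm[q]) Q-range
      k≤z : ∀ {k} → k ℕ.≤ 2 → ℕ→ℚ k ≤ z
      k≤z k≤2 = ℚ.≤-trans (ℕ→ℚ-mono-≤ k≤2) 2≤z
      Nm²*excess≤ : ∀ {q} → q ∈ Q → Nm q ℕ.* Nm q ℕ.* excess (v q) 1 A′ ℕ.≤ 72 ℕ.* Nm 𝒩
      Nm²*excess≤ q∈Q = Nm²*excess≤72Nm𝒩 (v _)
        (ℕ→ℚ-cancel-≤ (ℚ.≤-trans 2≤z (All.lookup z≤Nm q∈Q))) A′! A′-spec (exact _ _ q∈Q)
  in scaled-split T₁ S W (k≤z ℕ.z≤n)
       (exponent-sum-bound v A′ Q R A′! (λ q∈Q → divisible⊆R (v _) A′-spec (R-spec _) (exact _ _ q∈Q)))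
       (subst (z * ℕ→ℚ W ≤_) (trans (cong ℕ→ℚ (sym (ℕ.*-assoc 36 72 (Nm 𝒩)))) (ℕ→ℚ-* 2592 (Nm 𝒩)))
         (inverse-square-tail-ℚ _ _ Q (k≤z (ℕ.s≤s ℕ.z≤n)) (nonassociate⇒Unique Q-nonassociate) z≤Nm Nm²*excess≤))
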